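{- Let $G$ be a circuit with leaves labeled by literals over $\mathbf{I}$ and $\mathbf{X}$, let $\ell$ be a literal over $\mathbf{X}$ with underlying variable $v_\ell$, let $S_\ell$ (resp. $S_{\neg\ell}$) be the set of all $\ell$-leaves (resp. $\neg\ell$-leaves) of $G$, and suppose $S\subseteq S_\ell$ is $\wedge$-unrealizable in $G$. Let $p\notin\mathrm{set}(\mathbf{X})\cup\mathrm{set}(\mathbf{I})$ be fresh. Let $E=G|_{S_\ell\setminus S:(p\wedge\ell),\,S_{\neg\ell}:(\neg p\wedge\neg\ell)}$ and $H=E|_{\ell=\top,\neg\ell=\top}$ (so the leaves of $H$ are labeled by literals over $\mathbf{X}\setminus(v_\ell)$, $\mathbf{I}$ and $p$). Then: (1) $\exists v_\ell\,\varphi_G\iff\exists p\,\varphi_H\iff\exists v_\ell\,\varphi_{G|_{S:\top}}$. (2) If $\Psi_H(\mathbf{I})$ is a Skolem function vector for $(\mathbf{X}\setminus(v_\ell),p)$ in $\varphi_H$, then the projection of $\Psi_H$ onto the components for $\mathbf{X}\setminus(v_\ell)$, augmented with the function $\varphi_{E|_{\ell=\top,\neg\ell=\bot}}(\Psi_H(\mathbf{I}),\mathbf{I})$ as the Skolem function for the literal $\ell$, gives a Skolem function vector $\Psi_G(\mathbf{I})$ for $\mathbf{X}$ in $\varphi_G$.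
   Context: Boolean values are $\bot,\top$. $\mathbf{I}$ (system inputs) and $\mathbf{X}$ (system outputs) are disjoint sequences of Boolean variables; $\mathrm{set}(\mathbf{V})$ is the set of variables of $\mathbf{V}$; $\mathbf{X}\setminus(v)$ is $\mathbf{X}$ with $v$ removed. A circuit is an NNF circuit: a rooted DAG whose nodes are all descendants of the root, internal nodes labeled $\wedge$ or $\vee$ with two children, leaves labeled by literals or constants $\top,\bot$ (labels may repeat). $\varphi_G$ is the represented formula, $[\![\varphi_G]\!]$ its Boolean function. An $\ell$-leaf is a leaf labeled $\ell$. $G|_{L:b}$ relabels each leaf in a set $L$ by $b$, where relabeling by a formula such as $p\wedge\ell$ means replacing the leaf by a circuit for that formula; $G|_{\ell_1=b_1,\dots}$ relabels all $\ell_j$-leaves by $b_j$ ($\ell$ and $\neg\ell$ are distinct literals). $[\![\varphi]\!]_\sigma$ denotes substitution of an assignment $\sigma$. For a literal $\ell$ labeling a leaf of $G$ with variable $v_\ell$ and fresh $w,w'$: $\ell$ is $\wedge$-realizable in $G$ iff some assignment $\sigma$ to all variables of $G$ other than $v_\ell$ gives $[\![G|_{\ell=w,\neg\ell=w'}]\!]_\sigma=[\![w\wedge w']\!]$, else $\wedge$-unrealizable. A set $S$ of $\ell$-leaves, with $S'$ the set of all $\ell$-leaves, is $\wedge$-(un)realizable in $G$ iff $\ell$ is $\wedge$-(un)realizable in $G|_{S'\setminus S:\bot}$. A Skolem function vector for outputs $\mathbf{Y}$ in $\varphi(\mathbf{Y},\mathbf{I})$ is a sequence $\Psi(\mathbf{I})$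 of formulas over $\mathbf{I}$, one per variable of $\mathbf{Y}$, with $\forall\mathbf{I}\,(\varphi(\Psi(\mathbf{I}),\mathbf{I})\Leftrightarrow\exists\mathbf{Y}\varphi(\mathbf{Y},\mathbf{I}))$. A Skolem function for a literal $\ell$ gives the value of $\ell$ (so $v_\ell$ receives it if $\ell=v_\ell$ and its negation if $\ell=\neg v_\ell$). -}

module Defs where

open import Data.Bool using (Bool; true; false; not; _∧_; _∨_; if_then_else_)
open import Data.Nat using (ℕ; _≡ᵇ_)
open import Data.Nat.Properties using (_≟_)
open import Data.Product using (_×_; _,_; proj₁; proj₂; ∃)
open import Data.List using (List; []; _∷_; _++_; [_]; filter)
open import Data.List.Membership.DecPropositional _≟_ using (_∈_; _∉_; _∈?_)
open import Relation.Nullary using (does; ¬?)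
open import Relation.Binary.PropositionalEquality using (_≡_)

Var : Set
Var = ℕ

Assignment : Set
Assignment = Var → Bool

BoolFun : Set
BoolFun = Assignment → Bool

-- A literal: (polarity , variable); polarity true = positive literal v,
-- polarity false = negative literal ¬v.
Lit : Set
Lit = Bool × Var

var : Lit → Var
var = proj₂

neg : Lit → Lit
neg (b , v) = (not b , v)

data Label : Set where
  lit   : Lit → Label
  const : Bool → Label

-- A circuit is represented by its unfolding into a tree
--: leaves carry labels of type A, internal nodes are
-- binary ∧ / ∨.  Leaf *occurrences* (positions) are what sets of leaves
-- range over; a set of leaves is represented by a Boolean mark on each
-- leaf (Circ (Label × Bool)).

data Circ (A : Set) : Set where
  leaf : A → Circ A
  and  : Circ A → Circ A → Circ A
  or   : Circ A → Circ A → Circ A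

_>>=_ : {A B : Set} → Circ A → (A → Circ B) → Circ B
leaf a  >>= f = f a
and c d >>= f = and (c >>= f) (d >>= f)
or  c d >>= f = or  (c >>= f) (d >>= f)

leaves : {A : Set} → Circ A → List A
leaves (leaf a)  = a ∷ []
leaves (and c d) = leaves c ++ leaves d
leaves (or c d)  = leaves c ++ leaves d

litVal : Bool → Bool → Bool
litVal b x = if b then x else not x

⟦_⟧ : Circ Label → BoolFun
⟦ leaf (lit (b , v)) ⟧ σ = litVal b (σ v)
⟦ leaf (const b) ⟧ σ     = b
⟦ and c d ⟧ σ            = ⟦ c ⟧ σ ∧ ⟦ d ⟧ σ
⟦ or c d ⟧ σ             = ⟦ c ⟧ σ ∨ ⟦ d ⟧ σ

isLit : Lit → Label → Bool
isLit (b , v) (lit (b' , v')) = (if b then b' else not b') ∧ (v ≡ᵇ v')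
isLit ℓ (const _) = false

forget : Circ (Label × Bool) → Circ Label
forget G = G >>= λ x → leaf (proj₁ x)

relabelLit : Circ Label → Lit → Label → Label → Circ Label
relabelLit G ℓ a b = G >>= λ lab →
  if isLit ℓ lab then leaf a else if isLit (neg ℓ) lab then leaf b else leaf lab

_[_↦_] : Assignment → Var → Bool → Assignment
(σ [ v ↦ b ]) w = if w ≡ᵇ v then b else σ w

Ex : Var → BoolFun → BoolFun
Ex v φ σ = φ (σ [ v ↦ false ]) ∨ φ (σ [ v ↦ true ])

ExL : List Var → BoolFun → BoolFun
ExL []      φ = φ
ExL (y ∷ Y) φ = Ex y (ExL Y φ)

-- ℓ is ∧-realizable in G: some assignment σ to the variables other than
-- v_ℓ makes G|_{ℓ=w,¬ℓ=w'} compute w ∧ w' (as a function of the fresh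
-- w, w'; we range w, w' over their values a, b directly).
AndRealizable : Circ Label → Lit → Set
AndRealizable G ℓ =
  ∃ λ (σ : Assignment) → ∀ (a b : Bool) →
    ⟦ relabelLit G ℓ (const a) (const b) ⟧ σ ≡ (a ∧ b)

-- For a marked circuit Gm (marked leaves = the set S of ℓ-leaves):
-- S is ∧-realizable iff ℓ is ∧-realizable in G|_{S' \ S : ⊥}.
killUnmarked : Lit → Circ (Label × Bool) → Circ Label
killUnmarked ℓ Gm = Gm >>= λ x →
  if proj₂ x then leaf (proj₁ x)
  else if isLit ℓ (proj₁ x) then leaf (const false) else leaf (proj₁ x)

SetAndRealizable : Circ (Label × Bool) → Lit → Set
SetAndRealizable Gm ℓ = AndRealizable (killUnmarked ℓ Gm) ℓ

setMarkedTrue : Circ (Label × Bool) → Circ Label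
setMarkedTrue Gm = Gm >>= λ x →
  if proj₂ x then leaf (const true) else leaf (proj₁ x)

buildE : Lit → Var → Circ (Label × Bool) → Circ Label
buildE ℓ p Gm = Gm >>= λ x →
  if proj₂ x then leaf (proj₁ x)
  else if isLit ℓ (proj₁ x) then and (leaf (lit (true , p))) (leaf (lit ℓ))
  else if isLit (neg ℓ) (proj₁ x) then and (leaf (lit (false , p))) (leaf (lit (neg ℓ)))
  else leaf (proj₁ x)

-- A vector is given per variable name
-- (Ψ y is the Skolem function for y ∈ Y; values outside Y are ignored);
-- each component is a Boolean function depending only on the inputs I.

DependsOnly : List Var → BoolFun → Set
DependsOnly I f = ∀ (σ τ : Assignment) → (∀ i → i ∈ I → σ i ≡ τ i) → f σ ≡ f τ

subst : List Var → (Var → BoolFun) → Assignment → Assignment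
subst Y Ψ σ v = if does (v ∈? Y) then Ψ v σ else σ v

IsSkolem : List Var → List Var → BoolFun → (Var → BoolFun) → Set
IsSkolem Y I φ Ψ =
  (∀ y → y ∈ Y → DependsOnly I (Ψ y)) ×
  (∀ σ → φ (subst Y Ψ σ) ≡ ExL Y φ σ)

remove : Var → List Var → List Var
remove v = filter (λ x → ¬? (x ≟ v))

buildΨG : Lit → List Var → Circ Label → (Var → BoolFun) → Var → BoolFun
buildΨG ℓ YH E ΨH v σ =
  if v ≡ᵇ var ℓ
  then litVal (proj₁ ℓ) (⟦ relabelLit E ℓ (const true) (const false) ⟧ (subst YH ΨH σ))
  else ΨH v σ

module Submission where

-- Every circuit in the theorem is G with its leaves split into three groups, the marked set S, the other
-- ℓ-leaves and the ¬ℓ-leaves, each group receiving one common value x, y, z: G is f(ℓ, ℓ, ¬ℓ),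
-- G|_{S:⊤} is f(⊤, ℓ, ¬ℓ), H is f(⊤, p, ¬p), E|_{ℓ=⊤,¬ℓ=⊥} is f(⊤, p, ⊥), and ∧-unrealizability of S says
-- that (a, b) ↦ f(a, ⊥, b) is not a ∧ b.  Since G is in NNF, f is monotone in x and y, and from these
-- two facts alone a case analysis on the few values of f shows
--   f(⊥,⊥,⊤) ∨ f(⊤,⊤,⊥) = f(⊤,⊥,⊤) ∨ f(⊤,⊤,⊥),        (part 1)
--   f(⊤,q,¬q) implies f(b,b,¬b) for b = f(⊤,q,⊥).       (part 2)
-- The second turns a Skolem function for p in H into one for v_ℓ in G.

open import Defs
open import Data.Bool using (Bool; true; false; not; _∧_; _∨_; if_then_else_)
open import Data.Bool.Properties using (∧-identityʳ; ∧-zeroʳ; ∨-comm; ∨-zeroʳ; not-involutive; T-≡)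
open import Data.Empty using (⊥; ⊥-elim)
open import Data.Product using (_×_; _,_; proj₁; proj₂; ∃; map₁; map₂)
open import Data.Sum using (_⊎_; inj₁; inj₂)
open import Data.List using (List; []; _∷_; _++_; [_])
open import Data.List.Relation.Unary.All using (All; []; _∷_)
open import Data.List.Relation.Unary.All.Properties using (++⁻ˡ; ++⁻ʳ)
open import Data.List.Relation.Unary.Any using (here; there)
open import Data.Nat using (_≡ᵇ_)
open import Data.Nat.Properties using (_≟_; ≡ᵇ⇒≡; ≡⇒≡ᵇ)
open import Data.List.Membership.DecPropositional _≟_ using (_∈_; _∉_; _∈?_)
open import Data.List.Membership.Propositional.Properties using (∈-++⁺ˡ; ∈-++⁺ʳ; ∈-++⁻; ∈-filter⁺; ∈-filter⁻)
open import Function.Bundles using (Equivalence)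
open import Relation.Nullary using (¬_; yes; no; ¬?)
open import Relation.Binary.PropositionalEquality using (_≡_; _≢_; refl; sym; trans; cong; cong₂; module ≡-Reasoning)
open ≡-Reasoning

_⇒ᵇ_ : Bool → Bool → Set
a ⇒ᵇ b = a ≡ true → b ≡ true

⇒ᵇ-contra : ∀ {a b} → a ⇒ᵇ b → b ≡ false → a ≡ false
⇒ᵇ-contra {false} a⇒b b≡false = refl
⇒ᵇ-contra {true}  a⇒b b≡false = trans (sym (a⇒b refl)) b≡false

⇒ᵇ-antisym : ∀ {a b} → a ⇒ᵇ b → b ⇒ᵇ a → a ≡ b
⇒ᵇ-antisym {false} {false} a⇒b b⇒a = refl
⇒ᵇ-antisym {false} {true}  a⇒b b⇒a = b⇒a refl
⇒ᵇ-antisym {true}          a⇒b b⇒a = sym (a⇒b refl)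

≡ᵇ-sound : ∀ {m n} → (m ≡ᵇ n) ≡ true → m ≡ n
≡ᵇ-sound {m} {n} e = ≡ᵇ⇒≡ m n (Equivalence.from T-≡ e)

≡ᵇ-refl : ∀ m → (m ≡ᵇ m) ≡ true
≡ᵇ-refl m = Equivalence.to T-≡ (≡⇒≡ᵇ m m refl)

≢⇒≡ᵇ-false : ∀ {m n} → m ≢ n → (m ≡ᵇ n) ≡ false
≢⇒≡ᵇ-false {m} {n} m≢n with m ≡ᵇ n in e
... | true  = ⊥-elim (m≢n (≡ᵇ-sound e))
... | false = refl

[↦]-same : ∀ σ y b → (σ [ y ↦ b ]) y ≡ b
[↦]-same σ y b rewrite ≡ᵇ-refl y = refl

[↦]-other : ∀ σ y b {v} → v ≢ y → (σ [ y ↦ b ]) v ≡ σ v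
[↦]-other σ y b v≢y rewrite ≢⇒≡ᵇ-false v≢y = refl

litVal-not : ∀ b x → litVal (not b) x ≡ not (litVal b x)
litVal-not true  x = refl
litVal-not false x = sym (not-involutive x)

litVal-involutive : ∀ b x → litVal b (litVal b x) ≡ x
litVal-involutive true  x = refl
litVal-involutive false x = not-involutive x

∨-litVal : ∀ b (g : Bool → Bool) → g (litVal b false) ∨ g (litVal b true) ≡ g false ∨ g true
∨-litVal true  g = refl
∨-litVal false g = ∨-comm (g true) (g false)

isLit-sound : ∀ ℓ lab → isLit ℓ lab ≡ true → lab ≡ lit ℓ
isLit-sound (true  , v) (lit (true  , w)) e rewrite ≡ᵇ-sound {v} {w} e = refl
isLit-sound (false , v) (lit (false , w)) e rewrite ≡ᵇ-sound {v} {w} e = refl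
isLit-sound (true  , v) (lit (false , w)) ()
isLit-sound (false , v) (lit (true  , w)) ()

isLit-refl : ∀ ℓ → isLit ℓ (lit ℓ) ≡ true
isLit-refl (true  , v) rewrite ≡ᵇ-refl v = refl
isLit-refl (false , v) rewrite ≡ᵇ-refl v = refl

isLit-neg : ∀ ℓ → isLit ℓ (lit (neg ℓ)) ≡ false
isLit-neg (true  , v) = refl
isLit-neg (false , v) = refl

isLit-other-var : ∀ ℓ c → var c ≢ var ℓ → isLit ℓ (lit c) ≡ false
isLit-other-var (b , v) (b′ , w) w≢v rewrite ≢⇒≡ᵇ-false (λ v≡w → w≢v (sym v≡w)) = ∧-zeroʳ _

neither-isLit⇒other-var : ∀ ℓ c → isLit ℓ (lit c) ≡ false → isLit (neg ℓ) (lit c) ≡ false →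
  var c ≢ var ℓ
neither-isLit⇒other-var (true  , v) (true  , .v) e _ refl rewrite ≡ᵇ-refl v with e
... | ()
neither-isLit⇒other-var (true  , v) (false , .v) _ e refl rewrite ≡ᵇ-refl v with e
... | ()
neither-isLit⇒other-var (false , v) (true  , .v) _ e refl rewrite ≡ᵇ-refl v with e
... | ()
neither-isLit⇒other-var (false , v) (false , .v) e _ refl rewrite ≡ᵇ-refl v with e
... | ()

eval : {A : Set} → (A → Bool) → Circ A → Bool
eval f (leaf a)  = f a
eval f (and c d) = eval f c ∧ eval f d
eval f (or c d)  = eval f c ∨ eval f d

⟦>>=⟧ : {A : Set} (c : Circ A) (g : A → Circ Label) (σ : Assignment) →
  ⟦ c >>= g ⟧ σ ≡ eval (λ a → ⟦ g a ⟧ σ) c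
⟦>>=⟧ (leaf a)  g σ = refl
⟦>>=⟧ (and c d) g σ = cong₂ _∧_ (⟦>>=⟧ c g σ) (⟦>>=⟧ d g σ)
⟦>>=⟧ (or c d)  g σ = cong₂ _∨_ (⟦>>=⟧ c g σ) (⟦>>=⟧ d g σ)

>>=-assoc : {A B C : Set} (c : Circ A) (f : A → Circ B) (g : B → Circ C) →
  ((c >>= f) >>= g) ≡ (c >>= λ a → f a >>= g)
>>=-assoc (leaf a)  f g = refl
>>=-assoc (and c d) f g = cong₂ and (>>=-assoc c f g) (>>=-assoc d f g)
>>=-assoc (or c d)  f g = cong₂ or  (>>=-assoc c f g) (>>=-assoc d f g)

eval-cong : {A : Set} {P : A → Set} (f g : A → Bool) (c : Circ A) →
  All P (leaves c) → (∀ a → P a → f a ≡ g a) → eval f c ≡ eval g c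
eval-cong f g (leaf a)  (pa ∷ []) f≗g = f≗g a pa
eval-cong f g (and c d) all f≗g =
  cong₂ _∧_ (eval-cong f g c (++⁻ˡ (leaves c) all) f≗g) (eval-cong f g d (++⁻ʳ (leaves c) all) f≗g)
eval-cong f g (or c d)  all f≗g =
  cong₂ _∨_ (eval-cong f g c (++⁻ˡ (leaves c) all) f≗g) (eval-cong f g d (++⁻ʳ (leaves c) all) f≗g)

eval-mono : {A : Set} (f g : A → Bool) (c : Circ A) →
  (∀ a → f a ⇒ᵇ g a) → eval f c ⇒ᵇ eval g c
eval-mono f g (leaf a)  f⇒g e = f⇒g a e
eval-mono f g (and c d) f⇒g e with eval f c in ec | eval f d in ed
... | true | true rewrite eval-mono f g c f⇒g ec | eval-mono f g d f⇒g ed = refl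
eval-mono f g (or c d)  f⇒g e with eval f c in ec | eval f d in ed
... | true  | _    rewrite eval-mono f g c f⇒g ec = refl
... | false | true rewrite eval-mono f g d f⇒g ed = ∨-zeroʳ _

⟦⟧-ext : ∀ c σ τ → (∀ v → σ v ≡ τ v) → ⟦ c ⟧ σ ≡ ⟦ c ⟧ τ
⟦⟧-ext (leaf (lit (b , v))) σ τ σ≗τ = cong (litVal b) (σ≗τ v)
⟦⟧-ext (leaf (const b))     σ τ σ≗τ = refl
⟦⟧-ext (and c d)            σ τ σ≗τ = cong₂ _∧_ (⟦⟧-ext c σ τ σ≗τ) (⟦⟧-ext d σ τ σ≗τ)
⟦⟧-ext (or c d)             σ τ σ≗τ = cong₂ _∨_ (⟦⟧-ext c σ τ σ≗τ) (⟦⟧-ext d σ τ σ≗τ)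

relabelLeaf : Lit → Label → Label → Label → Circ Label
relabelLeaf ℓ a b lab = if isLit ℓ lab then leaf a else if isLit (neg ℓ) lab then leaf b else leaf lab

⟦relabelLeaf⟧-ℓ : ∀ ℓ a b σ → ⟦ relabelLeaf ℓ (const a) (const b) (lit ℓ) ⟧ σ ≡ a
⟦relabelLeaf⟧-ℓ ℓ a b σ rewrite isLit-refl ℓ = refl

⟦relabelLeaf⟧-¬ℓ : ∀ ℓ a b σ → ⟦ relabelLeaf ℓ (const a) (const b) (lit (neg ℓ)) ⟧ σ ≡ b
⟦relabelLeaf⟧-¬ℓ ℓ a b σ rewrite isLit-neg ℓ | isLit-refl (neg ℓ) = refl

⟦relabelLeaf⟧-other : ∀ ℓ a b σ lab → isLit ℓ lab ≡ false → isLit (neg ℓ) lab ≡ false →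
  ⟦ relabelLeaf ℓ a b lab ⟧ σ ≡ ⟦ leaf lab ⟧ σ
⟦relabelLeaf⟧-other ℓ a b σ lab e₁ e₂ rewrite e₁ | e₂ = refl

⟦relabelLeaf⟧-other-var : ∀ ℓ a b σ c → var c ≢ var ℓ →
  ⟦ relabelLeaf ℓ a b (lit c) ⟧ σ ≡ litVal (proj₁ c) (σ (var c))
⟦relabelLeaf⟧-other-var ℓ a b σ c c≢ℓ =
  ⟦relabelLeaf⟧-other ℓ a b σ (lit c) (isLit-other-var ℓ c c≢ℓ) (isLit-other-var (neg ℓ) c c≢ℓ)

-- Evaluation with the three groups of leaves set to x (marked), y (other ℓ) and z (¬ℓ)

slot : Lit → Assignment → Bool → Bool → Bool → Label × Bool → Bool
slot ℓ σ x y z (lab , true)  = x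
slot ℓ σ x y z (lab , false) = if isLit ℓ lab then y else if isLit (neg ℓ) lab then z else ⟦ leaf lab ⟧ σ

evalSlots : Lit → Circ (Label × Bool) → Assignment → Bool → Bool → Bool → Bool
evalSlots ℓ Gm σ x y z = eval (slot ℓ σ x y z) Gm

MarksOnly : Lit → Label × Bool → Set
MarksOnly ℓ x = proj₂ x ≡ true → proj₁ x ≡ lit ℓ

VarsIn : List Var → Label × Bool → Set
VarsIn V x = ∀ c → proj₁ x ≡ lit c → var c ∈ V

evalSlots-mono : ∀ ℓ Gm σ {x y z x′ y′ z′} → x ⇒ᵇ x′ → y ⇒ᵇ y′ → z ⇒ᵇ z′ →
  evalSlots ℓ Gm σ x y z ⇒ᵇ evalSlots ℓ Gm σ x′ y′ z′
evalSlots-mono ℓ Gm σ {x} {y} {z} {x′} {y′} {z′} x⇒x′ y⇒y′ z⇒z′ = eval-mono _ _ Gm slot-mono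
  where
  slot-mono : ∀ a → slot ℓ σ x y z a ⇒ᵇ slot ℓ σ x′ y′ z′ a
  slot-mono (lab , true) = x⇒x′
  slot-mono (lab , false) with isLit ℓ lab
  ... | true = y⇒y′
  ... | false with isLit (neg ℓ) lab
  ... | true  = z⇒z′
  ... | false = λ e → e

evalSlots-agree : ∀ ℓ Gm V σ τ → All (VarsIn V) (leaves Gm) →
  (∀ u → u ∈ V → u ≢ var ℓ → σ u ≡ τ u) →
  ∀ x y z → evalSlots ℓ Gm σ x y z ≡ evalSlots ℓ Gm τ x y z
evalSlots-agree ℓ Gm V σ τ vars σ≗τ x y z = eval-cong _ _ Gm vars slot-agree
  where
  slot-agree : ∀ a → VarsIn V a → slot ℓ σ x y z a ≡ slot ℓ τ x y z a
  slot-agree (lab , true) _ = refl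
  slot-agree (lab , false) inV with isLit ℓ lab in e₁
  ... | true = refl
  ... | false with isLit (neg ℓ) lab in e₂
  ... | true = refl
  ... | false with lab
  ... | const b = refl
  ... | lit c = cong (litVal (proj₁ c)) (σ≗τ (var c) (inV c refl) (neither-isLit⇒other-var ℓ c e₁ e₂))

slot-unmarked : ∀ ℓ σ lab x → ⟦ leaf lab ⟧ σ ≡
  slot ℓ σ x (litVal (proj₁ ℓ) (σ (var ℓ))) (not (litVal (proj₁ ℓ) (σ (var ℓ)))) (lab , false)
slot-unmarked ℓ σ lab x with isLit ℓ lab in e₁
... | true = cong (λ l → ⟦ leaf l ⟧ σ) (isLit-sound ℓ lab e₁)
... | false with isLit (neg ℓ) lab in e₂
... | true  = trans (cong (λ l → ⟦ leaf l ⟧ σ) (isLit-sound (neg ℓ) lab e₂)) (litVal-not (proj₁ ℓ) _)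
... | false = refl

module _ (ℓ : Lit) (Gm : Circ (Label × Bool)) (marks : All (MarksOnly ℓ) (leaves Gm)) (σ : Assignment) where

  private
    ℓσ : Bool
    ℓσ = litVal (proj₁ ℓ) (σ (var ℓ))

  ⟦forget⟧ : ⟦ forget Gm ⟧ σ ≡ evalSlots ℓ Gm σ ℓσ ℓσ (not ℓσ)
  ⟦forget⟧ = trans (⟦>>=⟧ Gm _ σ) (eval-cong _ _ Gm marks leaf-eq)
    where
    leaf-eq : ∀ a → MarksOnly ℓ a → ⟦ leaf (proj₁ a) ⟧ σ ≡ slot ℓ σ ℓσ ℓσ (not ℓσ) a
    leaf-eq (lab , true)  onlyℓ rewrite onlyℓ refl = refl
    leaf-eq (lab , false) _ = slot-unmarked ℓ σ lab ℓσ

  ⟦setMarkedTrue⟧ : ⟦ setMarkedTrue Gm ⟧ σ ≡ evalSlots ℓ Gm σ true ℓσ (not ℓσ)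
  ⟦setMarkedTrue⟧ = trans (⟦>>=⟧ Gm _ σ) (eval-cong _ _ Gm marks leaf-eq)
    where
    leaf-eq : ∀ a → MarksOnly ℓ a →
      ⟦ (if proj₂ a then leaf (const true) else leaf (proj₁ a)) ⟧ σ ≡ slot ℓ σ true ℓσ (not ℓσ) a
    leaf-eq (lab , true)  _ = refl
    leaf-eq (lab , false) _ = slot-unmarked ℓ σ lab true

  ⟦relabel-killUnmarked⟧ : ∀ a b →
    ⟦ relabelLit (killUnmarked ℓ Gm) ℓ (const a) (const b) ⟧ σ ≡ evalSlots ℓ Gm σ a false b
  ⟦relabel-killUnmarked⟧ a b =
    trans (cong (λ C → ⟦ C ⟧ σ) (>>=-assoc Gm _ (relabelLeaf ℓ (const a) (const b))))
          (trans (⟦>>=⟧ Gm _ σ) (eval-cong _ _ Gm marks leaf-eq))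
    where
    leaf-eq : ∀ x → MarksOnly ℓ x →
      ⟦ (if proj₂ x then leaf (proj₁ x) else if isLit ℓ (proj₁ x) then leaf (const false) else leaf (proj₁ x))
        >>= relabelLeaf ℓ (const a) (const b) ⟧ σ ≡ slot ℓ σ a false b x
    leaf-eq (lab , true) onlyℓ rewrite onlyℓ refl = ⟦relabelLeaf⟧-ℓ ℓ a b σ
    leaf-eq (lab , false) _ with isLit ℓ lab in e₁
    ... | true = refl
    ... | false rewrite e₁ with isLit (neg ℓ) lab
    ... | true  = refl
    ... | false = refl

  ⟦relabel-buildE⟧ : ∀ p → p ≢ var ℓ → ∀ a b →
    ⟦ relabelLit (buildE ℓ p Gm) ℓ (const a) (const b) ⟧ σ ≡ evalSlots ℓ Gm σ a (σ p ∧ a) (not (σ p) ∧ b)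
  ⟦relabel-buildE⟧ p p≢ℓ a b =
    trans (cong (λ C → ⟦ C ⟧ σ) (>>=-assoc Gm _ (relabelLeaf ℓ (const a) (const b))))
          (trans (⟦>>=⟧ Gm _ σ) (eval-cong _ _ Gm marks leaf-eq))
    where
    leaf-eq : ∀ x → MarksOnly ℓ x →
      ⟦ (if proj₂ x then leaf (proj₁ x)
         else if isLit ℓ (proj₁ x) then and (leaf (lit (true , p))) (leaf (lit ℓ))
         else if isLit (neg ℓ) (proj₁ x) then and (leaf (lit (false , p))) (leaf (lit (neg ℓ)))
         else leaf (proj₁ x))
        >>= relabelLeaf ℓ (const a) (const b) ⟧ σ ≡ slot ℓ σ a (σ p ∧ a) (not (σ p) ∧ b) x
    leaf-eq (lab , true) onlyℓ rewrite onlyℓ refl = ⟦relabelLeaf⟧-ℓ ℓ a b σ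
    leaf-eq (lab , false) _ with isLit ℓ lab in e₁
    ... | true = cong₂ _∧_ (⟦relabelLeaf⟧-other-var ℓ _ _ σ (true , p) p≢ℓ) (⟦relabelLeaf⟧-ℓ ℓ a b σ)
    ... | false with isLit (neg ℓ) lab in e₂
    ... | true  = cong₂ _∧_ (⟦relabelLeaf⟧-other-var ℓ _ _ σ (false , p) p≢ℓ) (⟦relabelLeaf⟧-¬ℓ ℓ a b σ)
    ... | false = ⟦relabelLeaf⟧-other ℓ _ _ σ lab e₁ e₂

-- The two Boolean facts behind the theorem

module MonotoneUnrealizable (f : Bool → Bool → Bool → Bool)
  (mono₁ : ∀ y z → f false y z ⇒ᵇ f true y z)
  (mono₂ : ∀ x z → f x false z ⇒ᵇ f x true z)
  (unrealizable : ¬ (∀ a b → f a false b ≡ a ∧ b)) where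

  private
    not-∧-table : f true false true ≡ true → f true false false ≡ false → f false false true ≡ false → ⊥
    not-∧-table f101 f100 f001 = unrealizable table
      where
      table : ∀ a b → f a false b ≡ a ∧ b
      table true  true  = f101
      table true  false = f100
      table false true  = f001
      table false false = ⇒ᵇ-contra (mono₁ false false) f100

  ∃-marked-⊤ : f false false true ∨ f true true false ≡ f true false true ∨ f true true false
  ∃-marked-⊤ with f true true false in f110
  ... | true = trans (∨-zeroʳ _) (sym (∨-zeroʳ _))
  ... | false with f false false true in f001
  ... | true rewrite mono₁ false true f001 = refl
  ... | false with f true false true in f101
  ... | false = refl
  ... | true  = ⊥-elim (not-∧-table f101 (⇒ᵇ-contra (mono₂ true false) f110) f001)

  diagonal-at-choice : ∀ q → f true q (not q) ≡ true →
    f (f true q false) (f true q false) (not (f true q false)) ≡ true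
  diagonal-at-choice true  f110 rewrite f110 = f110
  diagonal-at-choice false f101 with f true false false in f100
  ... | true = mono₂ true false f100
  ... | false with f false false true in f001
  ... | true  = refl
  ... | false = ⊥-elim (not-∧-table f101 f100 f001)

Agree : List Var → Assignment → Assignment → Set
Agree Y σ τ = ∀ v → v ∉ Y → σ v ≡ τ v

Agree-∷ : ∀ σ τ y Y → Agree (y ∷ Y) σ τ → Agree Y (σ [ y ↦ τ y ]) τ
Agree-∷ σ τ y Y σ≈τ v v∉Y with v ≟ y
... | yes refl = [↦]-same σ y (τ y)
... | no  v≢y  = trans ([↦]-other σ y (τ y) v≢y) (σ≈τ v λ { (here v≡y) → v≢y v≡y ; (there v∈Y) → v∉Y v∈Y })

Agree-[↦] : ∀ {σ τ} y b Y → Agree Y (σ [ y ↦ b ]) τ → Agree (y ∷ Y) σ τ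
Agree-[↦] {σ} y b Y σ′≈τ v v∉yY =
  trans (sym ([↦]-other σ y b (λ v≡y → v∉yY (here v≡y)))) (σ′≈τ v (λ v∈Y → v∉yY (there v∈Y)))

ExL-intro : ∀ Y c σ τ → Agree Y σ τ → ⟦ c ⟧ τ ≡ true → ExL Y ⟦ c ⟧ σ ≡ true
ExL-intro []      c σ τ σ≈τ cτ = trans (⟦⟧-ext c σ τ (λ v → σ≈τ v (λ ()))) cτ
ExL-intro (y ∷ Y) c σ τ σ≈τ cτ with τ y | ExL-intro Y c (σ [ y ↦ τ y ]) τ (Agree-∷ σ τ y Y σ≈τ) cτ
... | true  | ex = trans (cong (ExL Y ⟦ c ⟧ (σ [ y ↦ false ]) ∨_) ex) (∨-zeroʳ _)
... | false | ex rewrite ex = refl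

ExL-elim : ∀ Y φ σ → ExL Y φ σ ≡ true → ∃ λ τ → Agree Y σ τ × φ τ ≡ true
ExL-elim []      φ σ φσ = σ , (λ v _ → refl) , φσ
ExL-elim (y ∷ Y) φ σ ex with ExL Y φ (σ [ y ↦ false ]) in ex₀
... | true  = map₂ (map₁ (Agree-[↦] y false Y)) (ExL-elim Y φ _ ex₀)
... | false = map₂ (map₁ (Agree-[↦] y true Y)) (ExL-elim Y φ _ ex)

subst-∈ : ∀ Y Ψ σ {v} → v ∈ Y → subst Y Ψ σ v ≡ Ψ v σ
subst-∈ Y Ψ σ {v} v∈Y with v ∈? Y
... | yes _   = refl
... | no  v∉Y = ⊥-elim (v∉Y v∈Y)

subst-∉ : ∀ Y Ψ σ {v} → v ∉ Y → subst Y Ψ σ v ≡ σ v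
subst-∉ Y Ψ σ {v} v∉Y with v ∈? Y
... | yes v∈Y = ⊥-elim (v∉Y v∈Y)
... | no  _   = refl

module Construction
  (I X : List Var) (I∩X≡∅ : ∀ v → v ∈ I → v ∉ X)
  (Gm : Circ (Label × Bool)) (vars : All (VarsIn (I ++ X)) (leaves Gm))
  (ℓ : Lit) (vℓ∈X : var ℓ ∈ X) (marks : All (MarksOnly ℓ) (leaves Gm))
  (unrealizable : ¬ SetAndRealizable Gm ℓ)
  (p : Var) (p∉X : p ∉ X) (p∉I : p ∉ I)
  where

  vℓ : Var
  vℓ = var ℓ

  V : List Var
  V = I ++ X

  YH : List Var
  YH = remove vℓ X ++ [ p ]

  G E H E⊤⊥ : Circ Label
  G   = forget Gm
  E   = buildE ℓ p Gm
  H   = relabelLit E ℓ (const true) (const true)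
  E⊤⊥ = relabelLit E ℓ (const true) (const false)

  ℓ-val : Bool → Bool
  ℓ-val = litVal (proj₁ ℓ)

  p≢vℓ : p ≢ vℓ
  p≢vℓ refl = p∉X vℓ∈X

  p∉V : p ∉ V
  p∉V p∈V with ∈-++⁻ I p∈V
  ... | inj₁ p∈I = p∉I p∈I
  ... | inj₂ p∈X = p∉X p∈X

  p∈YH : p ∈ YH
  p∈YH = ∈-++⁺ʳ (remove vℓ X) (here refl)

  ∈YH : ∀ {u} → u ∈ X → u ≢ vℓ → u ∈ YH
  ∈YH u∈X u≢vℓ = ∈-++⁺ˡ (∈-filter⁺ (λ x → ¬? (x ≟ vℓ)) u∈X u≢vℓ)

  ∈I⇒∉YH : ∀ {u} → u ∈ I → u ∉ YH
  ∈I⇒∉YH {u} u∈I u∈YH with ∈-++⁻ (remove vℓ X) u∈YH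
  ... | inj₁ u∈X-vℓ     = I∩X≡∅ u u∈I (proj₁ (∈-filter⁻ (λ x → ¬? (x ≟ vℓ)) u∈X-vℓ))
  ... | inj₂ (here refl) = p∉I u∈I

  ∈V⇒∈YH⊎∈I : ∀ {u} → u ∈ V → u ≢ vℓ → u ∈ YH ⊎ u ∈ I
  ∈V⇒∈YH⊎∈I u∈V u≢vℓ with ∈-++⁻ I u∈V
  ... | inj₁ u∈I = inj₂ u∈I
  ... | inj₂ u∈X = inj₁ (∈YH u∈X u≢vℓ)

  f : Assignment → Bool → Bool → Bool → Bool
  f = evalSlots ℓ Gm

  f-agree : ∀ σ τ → (∀ u → u ∈ V → u ≢ vℓ → σ u ≡ τ u) → ∀ x y z → f σ x y z ≡ f τ x y z
  f-agree σ τ = evalSlots-agree ℓ Gm V σ τ vars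

  module Slots (σ : Assignment) = MonotoneUnrealizable (f σ)
    (λ y z → evalSlots-mono ℓ Gm σ (λ _ → refl) (λ e → e) (λ e → e))
    (λ x z → evalSlots-mono ℓ Gm σ (λ e → e) (λ _ → refl) (λ e → e))
    (λ f≡∧ → unrealizable (σ , λ a b → trans (⟦relabel-killUnmarked⟧ ℓ Gm marks σ a b) (f≡∧ a b)))

  ⟦G⟧[vℓ↦] : ∀ σ b → ⟦ G ⟧ (σ [ vℓ ↦ b ]) ≡ f σ (ℓ-val b) (ℓ-val b) (not (ℓ-val b))
  ⟦G⟧[vℓ↦] σ b = begin
      ⟦ G ⟧ (σ [ vℓ ↦ b ])
    ≡⟨ ⟦forget⟧ ℓ Gm marks _ ⟩
      f (σ [ vℓ ↦ b ]) (ℓ-val ((σ [ vℓ ↦ b ]) vℓ)) (ℓ-val ((σ [ vℓ ↦ b ]) vℓ)) (not (ℓ-val ((σ [ vℓ ↦ b ]) vℓ)))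
    ≡⟨ cong (λ s → f (σ [ vℓ ↦ b ]) (ℓ-val s) (ℓ-val s) (not (ℓ-val s))) ([↦]-same σ vℓ b) ⟩
      f (σ [ vℓ ↦ b ]) (ℓ-val b) (ℓ-val b) (not (ℓ-val b))
    ≡⟨ f-agree _ σ (λ u _ u≢vℓ → [↦]-other σ vℓ b u≢vℓ) _ _ _ ⟩
      f σ (ℓ-val b) (ℓ-val b) (not (ℓ-val b))
    ∎

  ⟦G|S:⊤⟧[vℓ↦] : ∀ σ b → ⟦ setMarkedTrue Gm ⟧ (σ [ vℓ ↦ b ]) ≡ f σ true (ℓ-val b) (not (ℓ-val b))
  ⟦G|S:⊤⟧[vℓ↦] σ b = begin
      ⟦ setMarkedTrue Gm ⟧ (σ [ vℓ ↦ b ])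
    ≡⟨ ⟦setMarkedTrue⟧ ℓ Gm marks _ ⟩
      f (σ [ vℓ ↦ b ]) true (ℓ-val ((σ [ vℓ ↦ b ]) vℓ)) (not (ℓ-val ((σ [ vℓ ↦ b ]) vℓ)))
    ≡⟨ cong (λ s → f (σ [ vℓ ↦ b ]) true (ℓ-val s) (not (ℓ-val s))) ([↦]-same σ vℓ b) ⟩
      f (σ [ vℓ ↦ b ]) true (ℓ-val b) (not (ℓ-val b))
    ≡⟨ f-agree _ σ (λ u _ u≢vℓ → [↦]-other σ vℓ b u≢vℓ) _ _ _ ⟩
      f σ true (ℓ-val b) (not (ℓ-val b))
    ∎

  ⟦H⟧ : ∀ σ → ⟦ H ⟧ σ ≡ f σ true (σ p) (not (σ p))
  ⟦H⟧ σ = trans (⟦relabel-buildE⟧ ℓ Gm marks σ p p≢vℓ true true)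
                (cong₂ (f σ true) (∧-identityʳ (σ p)) (∧-identityʳ (not (σ p))))

  ⟦E⊤⊥⟧ : ∀ σ → ⟦ E⊤⊥ ⟧ σ ≡ f σ true (σ p) false
  ⟦E⊤⊥⟧ σ = trans (⟦relabel-buildE⟧ ℓ Gm marks σ p p≢vℓ true false)
                  (cong₂ (f σ true) (∧-identityʳ (σ p)) (∧-zeroʳ (not (σ p))))

  ⟦H⟧[p↦] : ∀ σ b → ⟦ H ⟧ (σ [ p ↦ b ]) ≡ f σ true b (not b)
  ⟦H⟧[p↦] σ b = begin
      ⟦ H ⟧ (σ [ p ↦ b ])
    ≡⟨ ⟦H⟧ _ ⟩
      f (σ [ p ↦ b ]) true ((σ [ p ↦ b ]) p) (not ((σ [ p ↦ b ]) p))
    ≡⟨ cong (λ s → f (σ [ p ↦ b ]) true s (not s)) ([↦]-same σ p b) ⟩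
      f (σ [ p ↦ b ]) true b (not b)
    ≡⟨ f-agree _ σ (λ u u∈V _ → [↦]-other σ p b (λ { refl → p∉V u∈V })) _ _ _ ⟩
      f σ true b (not b)
    ∎

  ∃G≡∃H : ∀ σ → Ex vℓ ⟦ G ⟧ σ ≡ Ex p ⟦ H ⟧ σ
  ∃G≡∃H σ = begin
      ⟦ G ⟧ (σ [ vℓ ↦ false ]) ∨ ⟦ G ⟧ (σ [ vℓ ↦ true ])
    ≡⟨ cong₂ _∨_ (⟦G⟧[vℓ↦] σ false) (⟦G⟧[vℓ↦] σ true) ⟩
      f σ (ℓ-val false) (ℓ-val false) (not (ℓ-val false)) ∨ f σ (ℓ-val true) (ℓ-val true) (not (ℓ-val true))
    ≡⟨ ∨-litVal (proj₁ ℓ) (λ b → f σ b b (not b)) ⟩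
      f σ false false true ∨ f σ true true false
    ≡⟨ Slots.∃-marked-⊤ σ ⟩
      f σ true false true ∨ f σ true true false
    ≡⟨ sym (cong₂ _∨_ (⟦H⟧[p↦] σ false) (⟦H⟧[p↦] σ true)) ⟩
      ⟦ H ⟧ (σ [ p ↦ false ]) ∨ ⟦ H ⟧ (σ [ p ↦ true ])
    ∎

  ∃H≡∃G|S:⊤ : ∀ σ → Ex p ⟦ H ⟧ σ ≡ Ex vℓ ⟦ setMarkedTrue Gm ⟧ σ
  ∃H≡∃G|S:⊤ σ = begin
      ⟦ H ⟧ (σ [ p ↦ false ]) ∨ ⟦ H ⟧ (σ [ p ↦ true ])
    ≡⟨ cong₂ _∨_ (⟦H⟧[p↦] σ false) (⟦H⟧[p↦] σ true) ⟩
      f σ true false true ∨ f σ true true false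
    ≡⟨ sym (∨-litVal (proj₁ ℓ) (λ b → f σ true b (not b))) ⟩
      f σ true (ℓ-val false) (not (ℓ-val false)) ∨ f σ true (ℓ-val true) (not (ℓ-val true))
    ≡⟨ sym (cong₂ _∨_ (⟦G|S:⊤⟧[vℓ↦] σ false) (⟦G|S:⊤⟧[vℓ↦] σ true)) ⟩
      ⟦ setMarkedTrue Gm ⟧ (σ [ vℓ ↦ false ]) ∨ ⟦ setMarkedTrue Gm ⟧ (σ [ vℓ ↦ true ])
    ∎

  -- A model τ of G becomes a model of H by giving p the value of ℓ under τ (and v_ℓ, which H does not
  -- mention, its value under σ, as v_ℓ is not quantified in ∃YH).
  ∃YH-H-from-model-of-G : ∀ σ τ → Agree X σ τ → ⟦ G ⟧ τ ≡ true → ExL YH ⟦ H ⟧ σ ≡ true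
  ∃YH-H-from-model-of-G σ τ σ≈τ Gτ = ExL-intro YH H σ τ′ σ≈τ′ Hτ′
    where
    a : Bool
    a = ℓ-val (τ vℓ)

    τ′ : Assignment
    τ′ = (τ [ p ↦ a ]) [ vℓ ↦ σ vℓ ]

    τ′≈τ : ∀ u → u ∈ V → u ≢ vℓ → τ′ u ≡ τ u
    τ′≈τ u u∈V u≢vℓ = trans ([↦]-other (τ [ p ↦ a ]) vℓ (σ vℓ) u≢vℓ) ([↦]-other τ p a (λ { refl → p∉V u∈V }))

    σ≈τ′ : Agree YH σ τ′
    σ≈τ′ v v∉YH with v ≟ vℓ | v ≟ p
    ... | yes refl | _        = sym ([↦]-same (τ [ p ↦ a ]) vℓ (σ vℓ))
    ... | no  _    | yes refl = ⊥-elim (v∉YH p∈YH)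
    ... | no  v≢vℓ | no  v≢p  =
      trans (σ≈τ v (λ v∈X → v∉YH (∈YH v∈X v≢vℓ)))
            (sym (trans ([↦]-other (τ [ p ↦ a ]) vℓ (σ vℓ) v≢vℓ) ([↦]-other τ p a v≢p)))

    Hτ′ : ⟦ H ⟧ τ′ ≡ true
    Hτ′ = begin
        ⟦ H ⟧ τ′
      ≡⟨ ⟦H⟧ τ′ ⟩
        f τ′ true (τ′ p) (not (τ′ p))
      ≡⟨ cong (λ s → f τ′ true s (not s)) (trans ([↦]-other (τ [ p ↦ a ]) vℓ (σ vℓ) p≢vℓ) ([↦]-same τ p a)) ⟩
        f τ′ true a (not a)
      ≡⟨ f-agree τ′ τ τ′≈τ _ _ _ ⟩
        f τ true a (not a)
      ≡⟨ evalSlots-mono ℓ Gm τ (λ _ → refl) (λ e → e) (λ e → e) (trans (sym (⟦forget⟧ ℓ Gm marks τ)) Gτ) ⟩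
        true
      ∎

  module FromSkolemH (ΨH : Var → BoolFun) (ΨH-skolem : IsSkolem YH I ⟦ H ⟧ ΨH) where

    ΨG : Var → BoolFun
    ΨG = buildΨG ℓ YH E ΨH

    σH : Assignment → Assignment
    σH = subst YH ΨH

    ΨG-vℓ : ∀ σ → ΨG vℓ σ ≡ ℓ-val (⟦ E⊤⊥ ⟧ (σH σ))
    ΨG-vℓ σ rewrite ≡ᵇ-refl vℓ = refl

    ΨG-other : ∀ {u} σ → u ≢ vℓ → ΨG u σ ≡ ΨH u σ
    ΨG-other σ u≢vℓ rewrite ≢⇒≡ᵇ-false u≢vℓ = refl

    σH-agree : ∀ σ σ′ → (∀ i → i ∈ I → σ i ≡ σ′ i) → ∀ u → u ∈ YH ⊎ u ∈ I → σH σ u ≡ σH σ′ u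
    σH-agree σ σ′ σ≈σ′ u (inj₁ u∈YH) =
      trans (subst-∈ YH ΨH σ u∈YH) (trans (proj₁ ΨH-skolem u u∈YH σ σ′ σ≈σ′) (sym (subst-∈ YH ΨH σ′ u∈YH)))
    σH-agree σ σ′ σ≈σ′ u (inj₂ u∈I) =
      trans (subst-∉ YH ΨH σ (∈I⇒∉YH u∈I)) (trans (σ≈σ′ u u∈I) (sym (subst-∉ YH ΨH σ′ (∈I⇒∉YH u∈I))))

    ΨG-depends : ∀ y → y ∈ X → DependsOnly I (ΨG y)
    ΨG-depends y y∈X σ σ′ σ≈σ′ with y ≟ vℓ
    ... | no y≢vℓ = trans (ΨG-other σ y≢vℓ)
                      (trans (proj₁ ΨH-skolem y (∈YH y∈X y≢vℓ) σ σ′ σ≈σ′) (sym (ΨG-other σ′ y≢vℓ)))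
    ... | yes refl = begin
        ΨG vℓ σ
      ≡⟨ ΨG-vℓ σ ⟩
        ℓ-val (⟦ E⊤⊥ ⟧ (σH σ))
      ≡⟨ cong ℓ-val (⟦E⊤⊥⟧ (σH σ)) ⟩
        ℓ-val (f (σH σ) true (σH σ p) false)
      ≡⟨ cong (λ s → ℓ-val (f (σH σ) true s false)) (σH-agree σ σ′ σ≈σ′ p (inj₁ p∈YH)) ⟩
        ℓ-val (f (σH σ) true (σH σ′ p) false)
      ≡⟨ cong ℓ-val (f-agree _ _ (λ u u∈V u≢vℓ → σH-agree σ σ′ σ≈σ′ u (∈V⇒∈YH⊎∈I u∈V u≢vℓ)) _ _ _) ⟩
        ℓ-val (f (σH σ′) true (σH σ′ p) false)
      ≡⟨ sym (trans (ΨG-vℓ σ′) (cong ℓ-val (⟦E⊤⊥⟧ (σH σ′)))) ⟩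
        ΨG vℓ σ′
      ∎

    ⟦G⟧-at-ΨG : ∀ σ → let b = ⟦ E⊤⊥ ⟧ (σH σ) in ⟦ G ⟧ (subst X ΨG σ) ≡ f (σH σ) b b (not b)
    ⟦G⟧-at-ΨG σ = trans (⟦forget⟧ ℓ Gm marks ρ)
                    (trans (cong (λ s → f ρ s s (not s)) ρ-ℓ) (f-agree ρ (σH σ) ρ≈σH _ _ _))
      where
      ρ : Assignment
      ρ = subst X ΨG σ

      ρ-ℓ : ℓ-val (ρ vℓ) ≡ ⟦ E⊤⊥ ⟧ (σH σ)
      ρ-ℓ = trans (cong ℓ-val (trans (subst-∈ X ΨG σ vℓ∈X) (ΨG-vℓ σ))) (litVal-involutive (proj₁ ℓ) _)

      ρ≈σH : ∀ u → u ∈ V → u ≢ vℓ → ρ u ≡ σH σ u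
      ρ≈σH u u∈V u≢vℓ with ∈-++⁻ I u∈V
      ... | inj₁ u∈I = trans (subst-∉ X ΨG σ (I∩X≡∅ u u∈I)) (sym (subst-∉ YH ΨH σ (∈I⇒∉YH u∈I)))
      ... | inj₂ u∈X = trans (subst-∈ X ΨG σ u∈X)
                         (trans (ΨG-other σ u≢vℓ) (sym (subst-∈ YH ΨH σ (∈YH u∈X u≢vℓ))))

    ΨG-sound : ∀ σ → ⟦ G ⟧ (subst X ΨG σ) ≡ ExL X ⟦ G ⟧ σ
    ΨG-sound σ = ⇒ᵇ-antisym
      (ExL-intro X G σ (subst X ΨG σ) (λ v v∉X → sym (subst-∉ X ΨG σ v∉X)))
      (λ ex → complete (ExL-elim X ⟦ G ⟧ σ ex))
      where
      complete : (∃ λ τ → Agree X σ τ × ⟦ G ⟧ τ ≡ true) → ⟦ G ⟧ (subst X ΨG σ) ≡ true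
      complete (τ , σ≈τ , Gτ) = begin
          ⟦ G ⟧ (subst X ΨG σ)
        ≡⟨ ⟦G⟧-at-ΨG σ ⟩
          f (σH σ) (⟦ E⊤⊥ ⟧ (σH σ)) (⟦ E⊤⊥ ⟧ (σH σ)) (not (⟦ E⊤⊥ ⟧ (σH σ)))
        ≡⟨ cong (λ b → f (σH σ) b b (not b)) (⟦E⊤⊥⟧ (σH σ)) ⟩
          f (σH σ) (f (σH σ) true (σH σ p) false) (f (σH σ) true (σH σ p) false)
            (not (f (σH σ) true (σH σ p) false))
        ≡⟨ Slots.diagonal-at-choice (σH σ) (σH σ p) H-at-σH ⟩
          true
        ∎
        where
        H-at-σH : f (σH σ) true (σH σ p) (not (σH σ p)) ≡ true
        H-at-σH = trans (sym (⟦H⟧ (σH σ))) (trans (proj₂ ΨH-skolem σ) (∃YH-H-from-model-of-G σ τ σ≈τ Gτ))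

    ΨG-skolem : IsSkolem X I ⟦ G ⟧ ΨG
    ΨG-skolem = ΨG-depends , ΨG-sound

theorem1 : (I X : List Var) → (∀ v → v ∈ I → v ∉ X) →
    (Gm : Circ (Label × Bool)) →
    All (λ x → ∀ c → proj₁ x ≡ lit c → var c ∈ I ++ X) (leaves Gm) →
    (ℓ : Lit) → var ℓ ∈ X →
    All (λ x → proj₂ x ≡ true → proj₁ x ≡ lit ℓ) (leaves Gm) →
    ¬ SetAndRealizable Gm ℓ →
    (p : Var) → p ∉ X → p ∉ I →
    let G = forget Gm
        E = buildE ℓ p Gm
        H = relabelLit E ℓ (const true) (const true)
        YH = remove (var ℓ) X ++ [ p ]
    in
    (∀ σ → (Ex (var ℓ) ⟦ G ⟧ σ ≡ Ex p ⟦ H ⟧ σ)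
         × (Ex p ⟦ H ⟧ σ ≡ Ex (var ℓ) ⟦ setMarkedTrue Gm ⟧ σ))
    × (∀ ΨH → IsSkolem YH I ⟦ H ⟧ ΨH →
         IsSkolem X I ⟦ G ⟧ (buildΨG ℓ YH E ΨH))
theorem1 I X I∩X≡∅ Gm vars ℓ vℓ∈X marks unrealizable p p∉X p∉I =
  (λ σ → ∃G≡∃H σ , ∃H≡∃G|S:⊤ σ) , λ ΨH ΨH-skolem → FromSkolemH.ΨG-skolem ΨH ΨH-skolem
  where open Construction I X I∩X≡∅ Gm vars ℓ vℓ∈X marks unrealizable p p∉X p∉I
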